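{- Let $m$ be a positive integer and let $s\ge 1$ and $r_1,\ldots,r_s$ be integers with $0<r_1<r_2<\cdots<r_s\le m$. Then there exists at most one pair of sets $(C,D)$ of nonnegative integers such that $C\cup D=\{0,1,\ldots,m\}\setminus\{r_1,\ldots,r_s\}$, $0\in C$, $C\cap D=\emptyset$, and $R_C(k)=R_D(k)$ for all integers $0\le k\le m$.
   Context: For a set $S$ of nonnegative integers and an integer $n\ge 0$, $R_S(n)$ denotes the number of pairs $(s_1,s_2)$ with $s_1,s_2\in S$, $s_1<s_2$ and $s_1+s_2=n$. -}

module Defs where

open import Data.Nat using (ℕ; zero; suc; _+_; _∸_; _<ᵇ_)
open import Data.Bool using (Bool; true; false; _∧_)
open import Data.List using (List; length; filter; upTo)
open import Relation.Binary.PropositionalEquality using (_≡_)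
open import Relation.Nullary.Decidable using (Dec; yes; no)
open import Data.Bool.Properties using (_≟_)

NatSet : Set
NatSet = ℕ → Bool

isRep : NatSet → ℕ → ℕ → Bool
isRep S n s1 = (s1 <ᵇ (n ∸ s1)) ∧ (S s1 ∧ S (n ∸ s1))

-- R_S(n) = #{(s1,s2) : s1,s2 ∈ S, s1 < s2, s1 + s2 = n}.
-- Such pairs are determined by s1, which ranges over 0 ≤ s1 < n (here s1 ∈ upTo (suc n) = [0..n]).
R : NatSet → ℕ → ℕ
R S n = length (filter (λ s1 → isRep S n s1 ≟ true) (upTo (suc n)))

-- Induction on x shows that x's side in the split is forced. For x > 0,
-- R_S(x) = [0 ∈ S ∧ x ∈ S] + R⁺_S(x), where R⁺ counts the representations
-- x = s₁ + s₂ with 1 ≤ s₁ < s₂, so R⁺_S(x) only depends on S ∩ [0, x).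
-- If x ∈ C but x ∉ C′ for two splits agreeing below x, then, as 0 ∈ C and
-- 0 ∉ D, D′,  1 + R⁺_C(x) = R_C(x) = R_D(x) = R⁺_D(x) = R⁺_D′(x) = R_D′(x)
-- = R_C′(x) = R⁺_C′(x) = R⁺_C(x), which is absurd.
module Submission where

open import Defs
open import Data.Nat using (ℕ; zero; suc; _<_; _≤_; _∸_; _<ᵇ_; z≤n; s≤s)
open import Data.Nat.Properties using (<ᵇ⇒<; m∸n≤m; <-≤-trans; 1+n≢n)
open import Data.Nat.Induction using (<-rec)
open import Data.Fin using (Fin)
open import Data.Bool using (Bool; true; false; T; _∧_)
open import Data.Bool.Properties using (_≟_; ⇔→≡; ∧-zeroʳ; ¬-not)
open import Data.List using (length; filter; applyUpTo)
open import Data.Product using (∃; _×_; _,_; proj₁; proj₂)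
open import Data.Sum using (_⊎_; inj₁; inj₂)
open import Data.Empty using (⊥-elim)
open import Function using (_∘_)
open import Function.Bundles using (mk⇔)
open import Relation.Binary.PropositionalEquality
  using (_≡_; refl; sym; trans; cong; cong₂; subst; module ≡-Reasoning)
open import Relation.Nullary using (¬_)
import Data.Fin as F

R⁺ : NatSet → ℕ → ℕ
R⁺ S n = length (filter (λ s₁ → isRep S n s₁ ≟ true) (applyUpTo suc n))

AgreeBelow : ℕ → NatSet → NatSet → Set
AgreeBelow x S S′ = ∀ y → y < x → S y ≡ S′ y

R-suc-≡-suc-R⁺ : ∀ S k → S 0 ≡ true → S (suc k) ≡ true → R S (suc k) ≡ suc (R⁺ S (suc k))
R-suc-≡-suc-R⁺ S k s0 sx with S 0 | S (suc k)
R-suc-≡-suc-R⁺ S k refl refl | .true | .true = refl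

R-suc-≡-R⁺ : ∀ S k → (S 0 ∧ S (suc k)) ≡ false → R S (suc k) ≡ R⁺ S (suc k)
R-suc-≡-R⁺ S k ¬both with S 0 ∧ S (suc k)
R-suc-≡-R⁺ S k refl | .false = refl

length-filter-applyUpTo-cong : (f g : ℕ → Bool) (h : ℕ → ℕ) (n : ℕ) →
  (∀ i → i < n → f (h i) ≡ g (h i)) →
  length (filter (λ y → f y ≟ true) (applyUpTo h n)) ≡
  length (filter (λ y → g y ≟ true) (applyUpTo h n))
length-filter-applyUpTo-cong f g h zero f≡g = refl
length-filter-applyUpTo-cong f g h (suc n) f≡g with f (h 0) | g (h 0) | f≡g 0 (s≤s z≤n)
... | true  | .true  | refl = cong suc rest
  where rest = length-filter-applyUpTo-cong f g (h ∘ suc) n (λ i i<n → f≡g (suc i) (s≤s i<n))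
... | false | .false | refl = length-filter-applyUpTo-cong f g (h ∘ suc) n (λ i i<n → f≡g (suc i) (s≤s i<n))

isRep-suc-cong : ∀ S S′ x → AgreeBelow x S S′ → ∀ i → i < x → isRep S x (suc i) ≡ isRep S′ x (suc i)
isRep-suc-cong S S′ (suc k) S≡S′ i i<x with suc i <ᵇ (suc k ∸ suc i) in lt
... | false = refl
... | true  = cong₂ _∧_ (S≡S′ (suc i) (<-≤-trans i<k∸i (m∸n≤m (suc k) (suc i))))
                        (S≡S′ (suc k ∸ suc i) (s≤s (m∸n≤m k i)))
  where
  i<k∸i : suc i < suc k ∸ suc i
  i<k∸i = <ᵇ⇒< (suc i) (suc k ∸ suc i) (subst T (sym lt) _)

R⁺-cong : ∀ S S′ x → AgreeBelow x S S′ → R⁺ S x ≡ R⁺ S′ x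
R⁺-cong S S′ x S≡S′ =
  length-filter-applyUpTo-cong (isRep S x) (isRep S′ x) suc x (isRep-suc-cong S S′ x S≡S′)

balanced-∈-transfer : ∀ {S T S′ T′} k → AgreeBelow (suc k) S S′ → AgreeBelow (suc k) T T′ →
  S 0 ≡ true → T 0 ≡ false → T′ 0 ≡ false →
  R S (suc k) ≡ R T (suc k) → R S′ (suc k) ≡ R T′ (suc k) →
  S (suc k) ≡ true → S′ (suc k) ≡ true
balanced-∈-transfer {S} {T} {S′} {T′} k S≡S′ T≡T′ s0 t0 t′0 RS≡RT RS′≡RT′ sx = ¬-not λ s′x → 1+n≢n (begin
  suc (R⁺ S x)  ≡⟨ R-suc-≡-suc-R⁺ S k s0 sx ⟨
  R S x         ≡⟨ RS≡RT ⟩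
  R T x         ≡⟨ R-suc-≡-R⁺ T k (cong (_∧ T x) t0) ⟩
  R⁺ T x        ≡⟨ R⁺-cong T T′ x T≡T′ ⟩
  R⁺ T′ x       ≡⟨ R-suc-≡-R⁺ T′ k (cong (_∧ T′ x) t′0) ⟨
  R T′ x        ≡⟨ RS′≡RT′ ⟨
  R S′ x        ≡⟨ R-suc-≡-R⁺ S′ k (trans (cong (S′ 0 ∧_) s′x) (∧-zeroʳ (S′ 0))) ⟩
  R⁺ S′ x       ≡⟨ R⁺-cong S S′ x S≡S′ ⟨
  R⁺ S x        ∎)
  where
  open ≡-Reasoning
  x = suc k

record IsBalancedSplit (U : ℕ → Set) (C D : NatSet) : Set where
  field
    ∪⊆ : ∀ x → C x ≡ true ⊎ D x ≡ true → U x
    ⊆∪ : ∀ x → U x → C x ≡ true ⊎ D x ≡ true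
    0∈C : C 0 ≡ true
    disjoint : ∀ x → ¬ (C x ≡ true × D x ≡ true)
    balanced : ∀ k → U k → R C k ≡ R D k

  0∉D : D 0 ≡ false
  0∉D with D 0 in d0
  ... | false = refl
  ... | true  = ⊥-elim (disjoint 0 (0∈C , d0))

module _ {U : ℕ → Set} where

  private
    open IsBalancedSplit

    C-∈-transfer : ∀ {C D C′ D′} → IsBalancedSplit U C D → IsBalancedSplit U C′ D′ →
      ∀ x → AgreeBelow x C C′ → AgreeBelow x D D′ → C x ≡ true → C′ x ≡ true
    C-∈-transfer _ s′ zero    _ _ _ = 0∈C s′
    C-∈-transfer s s′ (suc k) C≡C′ D≡D′ cx =
      balanced-∈-transfer k C≡C′ D≡D′ (0∈C s) (0∉D s) (0∉D s′)
        (balanced s x ux) (balanced s′ x ux) cx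
      where
      x = suc k
      ux = ∪⊆ s x (inj₁ cx)

    D-∈-transfer : ∀ {C D C′ D′} → IsBalancedSplit U C D → IsBalancedSplit U C′ D′ →
      ∀ x → C x ≡ C′ x → D x ≡ true → D′ x ≡ true
    D-∈-transfer s s′ x C≡C′ dx with ⊆∪ s′ x (∪⊆ s x (inj₂ dx))
    ... | inj₁ c′x = ⊥-elim (disjoint s x (trans C≡C′ c′x , dx))
    ... | inj₂ d′x = d′x

  balancedSplit-unique : ∀ {C D C′ D′} → IsBalancedSplit U C D → IsBalancedSplit U C′ D′ →
    ∀ x → C x ≡ C′ x × D x ≡ D′ x
  balancedSplit-unique {C} {D} {C′} {D′} s s′ = <-rec _ step
    where
    step : ∀ x → (∀ {y} → y < x → C y ≡ C′ y × D y ≡ D′ y) → C x ≡ C′ x × D x ≡ D′ x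
    step x ih = C≡C′ , ⇔→≡ (mk⇔ (D-∈-transfer s s′ x C≡C′) (D-∈-transfer s′ s x (sym C≡C′)))
      where
      C≡C′ : C x ≡ C′ x
      C≡C′ = ⇔→≡ (mk⇔
        (C-∈-transfer s s′ x (λ y y<x → proj₁ (ih y<x)) (λ y y<x → proj₂ (ih y<x)))
        (C-∈-transfer s′ s x (λ y y<x → sym (proj₁ (ih y<x))) (λ y y<x → sym (proj₂ (ih y<x)))))

lemma1 : (m : ℕ) → 0 < m → (s : ℕ) → 1 ≤ s → (r : Fin s → ℕ)
    → (∀ i j → i F.< j → r i < r j)
    → (∀ i → 0 < r i)
    → (∀ i → r i ≤ m)
    → (C D C′ D′ : NatSet)
    → ((x : ℕ) → (C x ≡ true ⊎ D x ≡ true) → (x ≤ m × ¬ (∃ λ i → r i ≡ x)))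
    → ((x : ℕ) → (x ≤ m × ¬ (∃ λ i → r i ≡ x)) → (C x ≡ true ⊎ D x ≡ true))
    → C 0 ≡ true
    → ((x : ℕ) → ¬ (C x ≡ true × D x ≡ true))
    → ((k : ℕ) → k ≤ m → R C k ≡ R D k)
    → ((x : ℕ) → (C′ x ≡ true ⊎ D′ x ≡ true) → (x ≤ m × ¬ (∃ λ i → r i ≡ x)))
    → ((x : ℕ) → (x ≤ m × ¬ (∃ λ i → r i ≡ x)) → (C′ x ≡ true ⊎ D′ x ≡ true))
    → C′ 0 ≡ true
    → ((x : ℕ) → ¬ (C′ x ≡ true × D′ x ≡ true))
    → ((k : ℕ) → k ≤ m → R C′ k ≡ R D′ k)
    → ((x : ℕ) → C x ≡ C′ x) × ((x : ℕ) → D x ≡ D′ x)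
lemma1 m _ s _ r _ _ _ C D C′ D′ ∪⊆ ⊆∪ 0∈C disj bal ∪⊆′ ⊆∪′ 0∈C′ disj′ bal′ =
  (λ x → proj₁ (unique x)) , (λ x → proj₂ (unique x))
  where
  unique = balancedSplit-unique
    (record { ∪⊆ = ∪⊆ ; ⊆∪ = ⊆∪ ; 0∈C = 0∈C ; disjoint = disj ; balanced = λ k u → bal k (proj₁ u) })
    (record { ∪⊆ = ∪⊆′ ; ⊆∪ = ⊆∪′ ; 0∈C = 0∈C′ ; disjoint = disj′ ; balanced = λ k u → bal′ k (proj₁ u) })
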